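{- Let $\mathcal R=(R,\oplus,\le,0)$ be a distance magma and $S\subseteq R$ sum-complete. Then $S$ satisfies the four-values condition in $\mathcal R$ if and only if $\oplus_S$ is associative on $S$.
   Context: A distance magma is a structure $(R,\oplus,\le,0)$ with $\oplus$ binary, $0\in R$, such that $\le$ is a total order, $r\le r\oplus s$, $r\le t,s\le u\Rightarrow r\oplus s\le t\oplus u$, $\oplus$ commutative, $0$ an identity. $S\subseteq R$ is sum-complete if $0\in S$ and for all $r,s\in S$ the set $\{x\in S:x\le r\oplus s\}$ has a maximum, denoted $r\oplus_S s$. $(r,s,t)\in R^3$ is an $\mathcal R$-triangle if $r\le s\oplus t$, $s\le r\oplus t$, $t\le r\oplus s$. $S$ satisfies the four-values condition in $\mathcal R$ if for all $u_1,u_2,v_1,v_2\in S$: whenever some $s\in S$ makes $(s,u_1,u_2)$ and $(s,v_1,v_2)$ $\mathcal R$-triangles, some $t\in S$ makes $(t,u_1,v_1)$ and $(t,u_2,v_2)$ $\mathcal R$-triangles. -}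

module Defs where

open import Level using (Level; _⊔_; suc)
open import Data.Product using (Σ; _×_; _,_; proj₁; proj₂)
open import Relation.Binary.Core using (Rel)
open import Relation.Binary.Structures using (IsTotalOrder)
open import Relation.Binary.PropositionalEquality using (_≡_)

record DistanceMagma (a ℓ : Level) : Set (suc (a ⊔ ℓ)) where
  infixl 6 _⊕_
  infix 4 _≤_
  field
    Carrier      : Set a
    _⊕_          : Carrier → Carrier → Carrier
    _≤_          : Rel Carrier ℓ
    𝟘            : Carrier
    isTotalOrder : IsTotalOrder _≡_ _≤_
    ≤-⊕          : ∀ r s → r ≤ r ⊕ s
    ⊕-mono       : ∀ {r s t u} → r ≤ t → s ≤ u → r ⊕ s ≤ t ⊕ u
    ⊕-comm       : ∀ r s → r ⊕ s ≡ s ⊕ r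
    ⊕-identityˡ  : ∀ r → 𝟘 ⊕ r ≡ r

module _ {a ℓ : Level} (𝓡 : DistanceMagma a ℓ) where
  open DistanceMagma 𝓡

  Subset : (p : Level) → Set (a ⊔ suc p)
  Subset p = Carrier → Set p

  IsMaxBelow : {p : Level} → Subset p → Carrier → Carrier → Set (a ⊔ ℓ ⊔ p)
  IsMaxBelow S b m = S m × m ≤ b × (∀ x → S x → x ≤ b → x ≤ m)

  record SumComplete {p : Level} (S : Subset p) : Set (a ⊔ ℓ ⊔ p) where
    field
      zero∈S : S 𝟘
      max    : ∀ r s → S r → S s → Σ Carrier (IsMaxBelow S (r ⊕ s))

    -- r ⊕_S s  (the maximum is unique by antisymmetry, so this is well defined)
    ⊕S : ∀ r s → S r → S s → Carrier
    ⊕S r s rS sS = proj₁ (max r s rS sS)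

    ⊕S-∈ : ∀ r s (rS : S r) (sS : S s) → S (⊕S r s rS sS)
    ⊕S-∈ r s rS sS = proj₁ (proj₂ (max r s rS sS))

  Triangle : Carrier → Carrier → Carrier → Set ℓ
  Triangle r s t = r ≤ s ⊕ t × s ≤ r ⊕ t × t ≤ r ⊕ s

  FourValues : {p : Level} → Subset p → Set (a ⊔ ℓ ⊔ p)
  FourValues S = ∀ u₁ u₂ v₁ v₂ → S u₁ → S u₂ → S v₁ → S v₂ →
    Σ Carrier (λ s → S s × Triangle s u₁ u₂ × Triangle s v₁ v₂) →
    Σ Carrier (λ t → S t × Triangle t u₁ v₁ × Triangle t u₂ v₂)

  ⊕S-Associative : {p : Level} {S : Subset p} → SumComplete S → Set (a ⊔ p)
  ⊕S-Associative {S = S} SC = ∀ r s t (rS : S r) (sS : S s) (tS : S t) →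
    ⊕S (⊕S r s rS sS) t (⊕S-∈ r s rS sS) tS ≡ ⊕S r (⊕S s t sS tS) rS (⊕S-∈ s t sS tS)
    where open SumComplete SC

-- Sum-completeness makes x ≤ y ⊕ z equivalent to x ≤ y ⊕_S z for x, y, z ∈ S,
-- so only ⊕_S matters. Given r, s, t ∈ S, the triangles (r ⊕_S s, r, s) and
-- (r ⊕_S s, (r ⊕_S s) ⊕_S t, t) share their first side; the four-values
-- condition yields a side below s ⊕_S t which forces
-- (r ⊕_S s) ⊕_S t ≤ r ⊕_S (s ⊕_S t), and commutativity gives the converse.
-- Conversely, if u₁ ⊕_S v₁ ≤ u₂ ⊕_S v₂ (otherwise swap the indices), then
-- t = u₁ ⊕_S v₁ is a common side: bounding the shared side s of the given
-- triangles by u₁ ⊕_S u₂ and v₁ ⊕_S v₂ and reassociating puts u₂ and v₂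
-- below t ⊕_S v₂ and t ⊕_S u₂.
module Submission where

open import Defs
open import Level using (Level)
open import Function.Bundles using (_⇔_; mk⇔)
open import Data.Product using (Σ; _×_; _,_; proj₁; proj₂; swap)
open import Data.Sum using (inj₁; inj₂)
open import Relation.Binary.Bundles using (Poset)
open import Relation.Binary.PropositionalEquality
  using (_≡_; refl; sym; subst) renaming (trans to trans-≡)
open import Relation.Binary.Structures using (IsTotalOrder)
import Relation.Binary.Reasoning.PartialOrder as PartialOrderReasoning

module Triangles {a ℓ : Level} (𝓡 : DistanceMagma a ℓ) where
  open DistanceMagma 𝓡
  open IsTotalOrder isTotalOrder using (trans; reflexive)

  ≤-⊕ʳ : ∀ r s → s ≤ r ⊕ s
  ≤-⊕ʳ r s = subst (s ≤_) (⊕-comm s r) (≤-⊕ s r)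

  triangle-swap₂₃ : ∀ {r s t} → Triangle 𝓡 r s t → Triangle 𝓡 r t s
  triangle-swap₂₃ {s = s} {t} (r≤ , s≤ , t≤) = trans r≤ (reflexive (⊕-comm s t)) , t≤ , s≤

  triangle-swap₁₂ : ∀ {r s t} → Triangle 𝓡 r s t → Triangle 𝓡 s r t
  triangle-swap₁₂ {r} {s} (r≤ , s≤ , t≤) = s≤ , r≤ , trans t≤ (reflexive (⊕-comm r s))

  triangle-between : ∀ {r s t} → s ≤ r → t ≤ r → r ≤ s ⊕ t → Triangle 𝓡 r s t
  triangle-between {r} {s} {t} s≤r t≤r r≤ = r≤ , trans s≤r (≤-⊕ r t) , trans t≤r (≤-⊕ r s)

module SumCompleteSubset {a ℓ p : Level} (𝓡 : DistanceMagma a ℓ) (S : Subset 𝓡 p)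
    (SC : SumComplete 𝓡 S) where
  open DistanceMagma 𝓡
  open SumComplete SC
  open IsTotalOrder isTotalOrder using (trans; reflexive; antisym; total)
  open Triangles 𝓡

  El : Set _
  El = Σ Carrier S

  ⟦_⟧ : El → Carrier
  ⟦_⟧ = proj₁

  infixl 6 _⊕ₛ_
  _⊕ₛ_ : El → El → El
  x ⊕ₛ y = ⊕S ⟦ x ⟧ ⟦ y ⟧ (proj₂ x) (proj₂ y) , ⊕S-∈ ⟦ x ⟧ ⟦ y ⟧ (proj₂ x) (proj₂ y)

  ⊕ₛ-≤-⊕ : ∀ x y → ⟦ x ⊕ₛ y ⟧ ≤ ⟦ x ⟧ ⊕ ⟦ y ⟧
  ⊕ₛ-≤-⊕ x y = proj₁ (proj₂ (proj₂ (max _ _ (proj₂ x) (proj₂ y))))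

  ≤-⊕⇒≤-⊕ₛ : ∀ x y z → ⟦ x ⟧ ≤ ⟦ y ⟧ ⊕ ⟦ z ⟧ → ⟦ x ⟧ ≤ ⟦ y ⊕ₛ z ⟧
  ≤-⊕⇒≤-⊕ₛ x y z = proj₂ (proj₂ (proj₂ (max _ _ (proj₂ y) (proj₂ z)))) ⟦ x ⟧ (proj₂ x)

  ≤-⊕ₛˡ : ∀ x y → ⟦ x ⟧ ≤ ⟦ x ⊕ₛ y ⟧
  ≤-⊕ₛˡ x y = ≤-⊕⇒≤-⊕ₛ x x y (≤-⊕ ⟦ x ⟧ ⟦ y ⟧)

  ≤-⊕ₛʳ : ∀ x y → ⟦ y ⟧ ≤ ⟦ x ⊕ₛ y ⟧
  ≤-⊕ₛʳ x y = ≤-⊕⇒≤-⊕ₛ y x y (≤-⊕ʳ ⟦ x ⟧ ⟦ y ⟧)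

  ⊕ₛ-mono : ∀ {x x′ y y′} → ⟦ x ⟧ ≤ ⟦ x′ ⟧ → ⟦ y ⟧ ≤ ⟦ y′ ⟧ → ⟦ x ⊕ₛ y ⟧ ≤ ⟦ x′ ⊕ₛ y′ ⟧
  ⊕ₛ-mono {x} {x′} {y} {y′} x≤ y≤ =
    ≤-⊕⇒≤-⊕ₛ (x ⊕ₛ y) x′ y′ (trans (⊕ₛ-≤-⊕ x y) (⊕-mono x≤ y≤))

  ⊕ₛ-cong : ∀ {x x′ y y′} → ⟦ x ⟧ ≡ ⟦ x′ ⟧ → ⟦ y ⟧ ≡ ⟦ y′ ⟧ → ⟦ x ⊕ₛ y ⟧ ≡ ⟦ x′ ⊕ₛ y′ ⟧
  ⊕ₛ-cong x≡ y≡ = antisym (⊕ₛ-mono (reflexive x≡) (reflexive y≡))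
                          (⊕ₛ-mono (reflexive (sym x≡)) (reflexive (sym y≡)))

  ⊕ₛ-comm : ∀ x y → ⟦ x ⊕ₛ y ⟧ ≡ ⟦ y ⊕ₛ x ⟧
  ⊕ₛ-comm x y = antisym (comm≤ x y) (comm≤ y x)
    where
    comm≤ : ∀ x y → ⟦ x ⊕ₛ y ⟧ ≤ ⟦ y ⊕ₛ x ⟧
    comm≤ x y = ≤-⊕⇒≤-⊕ₛ (x ⊕ₛ y) y x (trans (⊕ₛ-≤-⊕ x y) (reflexive (⊕-comm ⟦ x ⟧ ⟦ y ⟧)))

  ⊕ₛ-reverse : ∀ x y z → ⟦ x ⊕ₛ (y ⊕ₛ z) ⟧ ≡ ⟦ z ⊕ₛ y ⊕ₛ x ⟧
  ⊕ₛ-reverse x y z = trans-≡ (⊕ₛ-comm x (y ⊕ₛ z))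
                             (⊕ₛ-cong {y ⊕ₛ z} {z ⊕ₛ y} {x} (⊕ₛ-comm y z) refl)

  triangle-⊕ₛ : ∀ x y → Triangle 𝓡 ⟦ x ⊕ₛ y ⟧ ⟦ x ⟧ ⟦ y ⟧
  triangle-⊕ₛ x y = triangle-between (≤-⊕ₛˡ x y) (≤-⊕ₛʳ x y) (⊕ₛ-≤-⊕ x y)

  Associativeₛ : Set _
  Associativeₛ = ∀ x y z → ⟦ x ⊕ₛ y ⊕ₛ z ⟧ ≡ ⟦ x ⊕ₛ (y ⊕ₛ z) ⟧

  poset : Poset _ _ _
  poset = record { isPartialOrder = IsTotalOrder.isPartialOrder isTotalOrder }
  open PartialOrderReasoning poset

  fourValues⇒assoc-≤ : FourValues 𝓡 S → ∀ x y z → ⟦ x ⊕ₛ y ⊕ₛ z ⟧ ≤ ⟦ x ⊕ₛ (y ⊕ₛ z) ⟧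
  fourValues⇒assoc-≤ fv x y z
    with fv _ _ _ _ (proj₂ x) (proj₂ y) (proj₂ (x ⊕ₛ y ⊕ₛ z)) (proj₂ z) sharedSide
    where
    sharedSide : Σ Carrier λ s → S s × Triangle 𝓡 s ⟦ x ⟧ ⟦ y ⟧ × Triangle 𝓡 s ⟦ x ⊕ₛ y ⊕ₛ z ⟧ ⟦ z ⟧
    sharedSide = ⟦ x ⊕ₛ y ⟧ , proj₂ (x ⊕ₛ y) , triangle-⊕ₛ x y ,
                 triangle-swap₁₂ (triangle-⊕ₛ (x ⊕ₛ y) z)
  ... | w , w∈S , (_ , _ , b≤w⊕x) , (w≤y⊕z , _) =
    ≤-⊕⇒≤-⊕ₛ (x ⊕ₛ y ⊕ₛ z) x (y ⊕ₛ z) (begin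
      ⟦ x ⊕ₛ y ⊕ₛ z ⟧        ≤⟨ b≤w⊕x ⟩
      w ⊕ ⟦ x ⟧              ≤⟨ ⊕-mono (≤-⊕⇒≤-⊕ₛ (w , w∈S) y z w≤y⊕z) (reflexive refl) ⟩
      ⟦ y ⊕ₛ z ⟧ ⊕ ⟦ x ⟧     ≡⟨ ⊕-comm _ _ ⟩
      ⟦ x ⟧ ⊕ ⟦ y ⊕ₛ z ⟧     ∎)

  fourValues⇒assoc : FourValues 𝓡 S → Associativeₛ
  fourValues⇒assoc fv x y z = antisym (fourValues⇒assoc-≤ fv x y z) (begin
    ⟦ x ⊕ₛ (y ⊕ₛ z) ⟧      ≡⟨ ⊕ₛ-reverse x y z ⟩
    ⟦ z ⊕ₛ y ⊕ₛ x ⟧        ≤⟨ fourValues⇒assoc-≤ fv z y x ⟩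
    ⟦ z ⊕ₛ (y ⊕ₛ x) ⟧      ≡⟨ ⊕ₛ-reverse z y x ⟩
    ⟦ x ⊕ₛ y ⊕ₛ z ⟧        ∎)

  ≤-⊕ₛ-substˡ : ∀ {a b c d} (s : El) → ⟦ s ⟧ ≤ ⟦ a ⟧ ⊕ ⟦ b ⟧ → ⟦ c ⟧ ≤ ⟦ s ⟧ ⊕ ⟦ d ⟧ →
                ⟦ c ⟧ ≤ ⟦ a ⊕ₛ b ⊕ₛ d ⟧
  ≤-⊕ₛ-substˡ {a} {b} {c} {d} s s≤ c≤ =
    ≤-⊕⇒≤-⊕ₛ c (a ⊕ₛ b) d (trans c≤ (⊕-mono (≤-⊕⇒≤-⊕ₛ s a b s≤) (reflexive refl)))

  assoc⇒common-side-≤ : Associativeₛ → ∀ {u₁ u₂ v₁ v₂} (s : El) →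
    Triangle 𝓡 ⟦ s ⟧ ⟦ u₁ ⟧ ⟦ u₂ ⟧ → Triangle 𝓡 ⟦ s ⟧ ⟦ v₁ ⟧ ⟦ v₂ ⟧ →
    ⟦ u₁ ⊕ₛ v₁ ⟧ ≤ ⟦ u₂ ⊕ₛ v₂ ⟧ →
    Triangle 𝓡 ⟦ u₁ ⊕ₛ v₁ ⟧ ⟦ u₁ ⟧ ⟦ v₁ ⟧ × Triangle 𝓡 ⟦ u₁ ⊕ₛ v₁ ⟧ ⟦ u₂ ⟧ ⟦ v₂ ⟧
  assoc⇒common-side-≤ assoc {u₁} {u₂} {v₁} {v₂} s
                      (s≤u₁⊕u₂ , _ , u₂≤s⊕u₁) (s≤v₁⊕v₂ , _ , v₂≤s⊕v₁) t≤ =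
    triangle-⊕ₛ u₁ v₁ , trans t≤ (⊕ₛ-≤-⊕ u₂ v₂) , u₂≤t⊕v₂ , v₂≤t⊕u₂
    where
    u₂≤t⊕v₂ : ⟦ u₂ ⟧ ≤ ⟦ u₁ ⊕ₛ v₁ ⟧ ⊕ ⟦ v₂ ⟧
    u₂≤t⊕v₂ = begin
      ⟦ u₂ ⟧                   ≤⟨ ≤-⊕ₛ-substˡ {v₁} {v₂} {u₂} {u₁} s s≤v₁⊕v₂ u₂≤s⊕u₁ ⟩
      ⟦ v₁ ⊕ₛ v₂ ⊕ₛ u₁ ⟧       ≡⟨ ⊕ₛ-comm (v₁ ⊕ₛ v₂) u₁ ⟩
      ⟦ u₁ ⊕ₛ (v₁ ⊕ₛ v₂) ⟧     ≡⟨ sym (assoc u₁ v₁ v₂) ⟩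
      ⟦ u₁ ⊕ₛ v₁ ⊕ₛ v₂ ⟧       ≤⟨ ⊕ₛ-≤-⊕ (u₁ ⊕ₛ v₁) v₂ ⟩
      ⟦ u₁ ⊕ₛ v₁ ⟧ ⊕ ⟦ v₂ ⟧    ∎
    v₂≤t⊕u₂ : ⟦ v₂ ⟧ ≤ ⟦ u₁ ⊕ₛ v₁ ⟧ ⊕ ⟦ u₂ ⟧
    v₂≤t⊕u₂ = begin
      ⟦ v₂ ⟧                   ≤⟨ ≤-⊕ₛ-substˡ {u₁} {u₂} {v₂} {v₁} s s≤u₁⊕u₂ v₂≤s⊕v₁ ⟩
      ⟦ u₁ ⊕ₛ u₂ ⊕ₛ v₁ ⟧       ≡⟨ assoc u₁ u₂ v₁ ⟩
      ⟦ u₁ ⊕ₛ (u₂ ⊕ₛ v₁) ⟧     ≡⟨ ⊕ₛ-cong {x = u₁} {y = u₂ ⊕ₛ v₁} {y′ = v₁ ⊕ₛ u₂} refl (⊕ₛ-comm u₂ v₁) ⟩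
      ⟦ u₁ ⊕ₛ (v₁ ⊕ₛ u₂) ⟧     ≡⟨ sym (assoc u₁ v₁ u₂) ⟩
      ⟦ u₁ ⊕ₛ v₁ ⊕ₛ u₂ ⟧       ≤⟨ ⊕ₛ-≤-⊕ (u₁ ⊕ₛ v₁) u₂ ⟩
      ⟦ u₁ ⊕ₛ v₁ ⟧ ⊕ ⟦ u₂ ⟧    ∎

  assoc⇒fourValues : Associativeₛ → FourValues 𝓡 S
  assoc⇒fourValues assoc u₁ u₂ v₁ v₂ u₁∈S u₂∈S v₁∈S v₂∈S (s , s∈S , s-u , s-v)
    with total (⊕S u₁ v₁ u₁∈S v₁∈S) (⊕S u₂ v₂ u₂∈S v₂∈S)
  ... | inj₁ le = _ , ⊕S-∈ u₁ v₁ u₁∈S v₁∈S ,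
                 assoc⇒common-side-≤ assoc (s , s∈S) s-u s-v le
  ... | inj₂ ge = _ , ⊕S-∈ u₂ v₂ u₂∈S v₂∈S , swap
                 (assoc⇒common-side-≤ assoc (s , s∈S) (triangle-swap₂₃ s-u) (triangle-swap₂₃ s-v) ge)

proposition5p7 : {a ℓ p : Level} (𝓡 : DistanceMagma a ℓ) (S : Subset 𝓡 p)
    (SC : SumComplete 𝓡 S) → FourValues 𝓡 S ⇔ ⊕S-Associative 𝓡 SC
proposition5p7 𝓡 S SC = mk⇔
  (λ fv r s t r∈S s∈S t∈S → fourValues⇒assoc fv (r , r∈S) (s , s∈S) (t , t∈S))
  (λ assoc → assoc⇒fourValues (λ x y z → assoc _ _ _ (proj₂ x) (proj₂ y) (proj₂ z)))
  where open SumCompleteSubset 𝓡 S SC
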